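{- There exists a family of instances, consisting of greedy systems $(A,r)$ with $n=|E|$ columns (for arbitrarily large $n$) and cost vectors $c$, such that the integrality gap of the truncation (T) — the ratio between the optimal value of (T) and the optimal value of its linear programming relaxation $\min\{c^Tx: A'x\ge r,\ x\in\mathbb{R}^E_{\ge0}\}$ — is linear in $n$, i.e. $\Omega(n)$.
   Context: For a finite set $E$ of columns, a finite row set $\mathcal{L}$, $A\in\mathbb{R}^{\mathcal{L}\times E}_{\ge0}$, $r:\mathcal{L}\to\mathbb{R}$ and a partial order $\preceq$ on $\mathcal{L}$, with $\mathrm{supp}(i)=\{e: a_{i,e}>0\}$: $(A,r)$ is a greedy system if (P1) $r(S)\le r(T)$ whenever $S\preceq T$; (P2) $a_{S,e}\le a_{T,e}$ for every $e$ whenever $S\preceq T$; (P3) $(\mathcal{L},\preceq)$ is a modular lattice with join $\vee$ and meet $\wedge$, distinct rows have distinct supports, and $e\notin\mathrm{supp}(i)\cup\mathrm{supp}(j)$ implies $e\notin\mathrm{supp}(i\vee j)$; (P4) $\frac{r(T)-r(S\wedge T)}{a_{T,e}}\le\frac{r(S\vee T)-r(S)}{a_{S\vee T,e}}$ for all $S,T\in\mathcal{L}$ and $e\in T\setminus(S\wedge T)$. Rows are identified with their supports. For $S\in\mathcal{L}$, $e\in E$: $\varphi_e(S)=\max\{T\in\mathcal{L}:T\preceq S, e\notin T\}$; $t^+=\max\{t,0\}$. The truncation $A'$ has entries $a'_{S,e}=\min\{a_{S,e}, r(S)^+-r(\varphi_e(S))^+\}$, and (T) is $\min\{c^Tx: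 A'x\ge r, x\in\mathbb{Z}^E_{\ge0}\}$ with $c\in\mathbb{R}^E_{\ge0}$.
   Formalization: The entries of A, the values of r and the costs c are taken in ℚ, and LP optimality is checked only against rational vectors rather than all of $\mathbb{R}^E_{\ge0}$. -}

module Defs where

open import Data.Nat as ℕ using (ℕ; zero; suc)
open import Data.Fin using (Fin; zero; suc)
open import Data.Integer using (+_)
open import Data.Rational using (ℚ; 0ℚ; _+_; _*_; _-_; _⊔_; _⊓_; _≤_; _<_; _/_)
open import Data.Product using (Σ; _×_; _,_)
open import Relation.Binary.PropositionalEquality using (_≡_)
open import Relation.Binary.Lattice.Structures using (IsLattice)
open import Relation.Nullary using (¬_)
open import Function.Bundles using (_⇔_)

ℕ→ℚ : ℕ → ℚ
ℕ→ℚ k = + k / 1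

_⁺ : ℚ → ℚ
t ⁺ = t ⊔ 0ℚ

sumFin : (n : ℕ) → (Fin n → ℚ) → ℚ
sumFin zero    f = 0ℚ
sumFin (suc n) f = f zero + sumFin n (λ i → f (suc i))

-- A greedy system (A , r) with column set E = Fin n and row set L = Fin m,
-- with rational data.
record GreedySystem (n m : ℕ) : Set₁ where
  field
    a   : Fin m → Fin n → ℚ
    r   : Fin m → ℚ
    _≼_ : Fin m → Fin m → Set
    _∨_ : Fin m → Fin m → Fin m
    _∧_ : Fin m → Fin m → Fin m
    a-nonneg : ∀ i e → 0ℚ ≤ a i e
    P1 : ∀ S T → S ≼ T → r S ≤ r T
    P2 : ∀ S T → S ≼ T → ∀ e → a S e ≤ a T e
    -- (P3) (L, ≼) is a lattice with join ∨ and meet ∧ ...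
    lattice : IsLattice _≡_ _≼_ _∨_ _∧_
    modular : ∀ x y z → x ≼ z → (x ∨ (y ∧ z)) ≡ ((x ∨ y) ∧ z)
    distinctSupp : ∀ i j → (∀ e → (0ℚ < a i e) ⇔ (0ℚ < a j e)) → i ≡ j
    joinSupp : ∀ i j e → ¬ (0ℚ < a i e) → ¬ (0ℚ < a j e) → ¬ (0ℚ < a (i ∨ j) e)
    -- (P4), cross-multiplied by the positive denominators a_{T,e} and a_{S∨T,e}
    P4 : ∀ S T e → 0ℚ < a T e → ¬ (0ℚ < a (S ∧ T) e) →
         ((r T - r (S ∧ T)) * a (S ∨ T) e) ≤ ((r (S ∨ T) - r S) * a T e)

  IsPhi : (Fin n → Fin m → Fin m) → Set
  IsPhi φ = ∀ e S → (φ e S ≼ S) × ¬ (0ℚ < a (φ e S) e) ×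
                    (∀ T → T ≼ S → ¬ (0ℚ < a T e) → T ≼ φ e S)

  trunc : (Fin n → Fin m → Fin m) → Fin m → Fin n → ℚ
  trunc φ S e = a S e ⊓ ((r S ⁺) - (r (φ e S) ⁺))

FeasibleQ : ∀ {n m} → (Fin m → Fin n → ℚ) → (Fin m → ℚ) → (Fin n → ℚ) → Set
FeasibleQ {n} A' r x = (∀ e → 0ℚ ≤ x e) × (∀ S → r S ≤ sumFin n (λ e → A' S e * x e))

FeasibleN : ∀ {n m} → (Fin m → Fin n → ℚ) → (Fin m → ℚ) → (Fin n → ℕ) → Set
FeasibleN A' r x = FeasibleQ A' r (λ e → ℕ→ℚ (x e))

cost : ∀ {n} → (Fin n → ℚ) → (Fin n → ℚ) → ℚ
cost {n} c x = sumFin n (λ e → c e * x e)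

-- Rows are all subsets S of E = {0,…,n-1}, ordered by inclusion (a distributive, hence
-- modular, lattice), with a_{S,e} = (n choose k)·[e ∈ S] and r(S) = (|S| choose k).
-- Convexity of c ↦ (c choose k) makes r supermodular, which is (P4) since a is constant on
-- supports.  By Pascal's rule the truncated entries are a'_{S,e} = (|S|-1 choose k-1)·[e ∈ S],
-- and by absorption the point x = 1/k is tight in every row.  With the row of E as cost vector,
-- every fractional solution costs at least r(E) = (n choose k), so 1/k is LP-optimal.  An
-- integer solution vanishing on a set Z gives row Z the value 0 ≥ r(Z), forcing |Z| < k; so it
-- has at least n-k+1 nonzero entries, while a 0/1 vector with n-k+1 ones is feasible.  The ratio
-- is (n-k+1)(n-1 choose k-1)/(n choose k) = (n-k+1)k/n, which is (k+1)/2 ≥ n/4 when n = 2k.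

module Submission where

open import Defs
open import Data.Nat using (ℕ)
open import Data.Product using (_,_)
open import Function.Bundles using (_↔_; Inverse; Injection)
open import Function.Properties.Inverse using (Inverse⇒Injection)
open import Relation.Binary.PropositionalEquality
open import Relation.Binary.Lattice.Structures using (IsLattice)


module Binomial where

  open import Data.Nat
  open import Data.Nat.Properties
  open import Data.Nat.Combinatorics
    using (_C_; nCk+nC[k+1]≡[n+1]C[k+1]; k>n⇒nCk≡0; nCk≡nC[n∸k]; nCn≡1; nC1≡n) public
  open import Data.Nat.Tactic.RingSolver using (solve-∀)
  open import Data.Sum using (inj₁; inj₂)
  open import Relation.Nullary using (yes; no; contradiction)
  open import Algebra.Properties.CommutativeSemigroup *-commutativeSemigroup using (x∙yz≈y∙xz)

  nC0≡1 : ∀ n → n C 0 ≡ 1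
  nC0≡1 n = trans (nCk≡nC[n∸k] {n = n} z≤n) (nCn≡1 n)

  nCk≤[n+1]Ck : ∀ n k → n C k ≤ suc n C k
  nCk≤[n+1]Ck n zero    = ≤-reflexive (trans (nC0≡1 n) (sym (nC0≡1 (suc n))))
  nCk≤[n+1]Ck n (suc k) = ≤-trans (m≤n+m _ (n C k)) (≤-reflexive (nCk+nC[k+1]≡[n+1]C[k+1] n k))

  C-monoˡ-≤ : ∀ k {m n} → m ≤ n → m C k ≤ n C k
  C-monoˡ-≤ k {n = zero}  z≤n   = ≤-refl
  C-monoˡ-≤ k {n = suc n} m≤1+n with m≤n⇒m<n∨m≡n m≤1+n
  ... | inj₂ refl  = ≤-refl
  ... | inj₁ m<1+n = ≤-trans (C-monoˡ-≤ k (≤-pred m<1+n)) (nCk≤[n+1]Ck n k)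

  k≤n⇒0<nCk : ∀ {n k} → k ≤ n → 0 < n C k
  k≤n⇒0<nCk {n}     {zero}  _         = ≤-reflexive (sym (nC0≡1 n))
  k≤n⇒0<nCk {suc n} {suc k} (s≤s k≤n) =
    ≤-trans (k≤n⇒0<nCk k≤n) (≤-trans (m≤m+n _ _) (≤-reflexive (nCk+nC[k+1]≡[n+1]C[k+1] n k)))

  [n+1]*nCk≡[k+1]*[n+1]C[k+1] : ∀ n k → suc n * (n C k) ≡ suc k * (suc n C suc k)
  [n+1]*nCk≡[k+1]*[n+1]C[k+1] zero zero = refl
  [n+1]*nCk≡[k+1]*[n+1]C[k+1] zero (suc k) = begin
    1 * (0 C suc k)                  ≡⟨ cong (1 *_) (k>n⇒nCk≡0 {0} {suc k} (s≤s z≤n)) ⟩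
    0                                ≡⟨ sym (*-zeroʳ (suc (suc k))) ⟩
    suc (suc k) * 0                  ≡⟨ cong (suc (suc k) *_) (sym (k>n⇒nCk≡0 {1} {suc (suc k)} (s≤s (s≤s z≤n)))) ⟩
    suc (suc k) * (1 C suc (suc k))  ∎
    where open ≡-Reasoning
  [n+1]*nCk≡[k+1]*[n+1]C[k+1] (suc n) zero = begin
    suc (suc n) * (suc n C 0)        ≡⟨ cong (suc (suc n) *_) (nC0≡1 (suc n)) ⟩
    suc (suc n) * 1                  ≡⟨ *-identityʳ (suc (suc n)) ⟩
    suc (suc n)                      ≡⟨ sym (nC1≡n (suc (suc n))) ⟩
    suc (suc n) C 1                  ≡⟨ sym (*-identityˡ _) ⟩
    1 * (suc (suc n) C 1)            ∎
    where open ≡-Reasoning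
  [n+1]*nCk≡[k+1]*[n+1]C[k+1] (suc n) (suc k) = begin
    suc (suc n) * X                              ≡⟨⟩
    X + suc n * X                                ≡⟨ cong (λ x → X + suc n * x) (sym (nCk+nC[k+1]≡[n+1]C[k+1] n k)) ⟩
    X + suc n * (n C k + n C suc k)              ≡⟨ cong (X +_) (*-distribˡ-+ (suc n) (n C k) _) ⟩
    X + (suc n * (n C k) + suc n * (n C suc k))  ≡⟨ cong₂ (λ x y → X + (x + y))
                                                          ([n+1]*nCk≡[k+1]*[n+1]C[k+1] n k)
                                                          ([n+1]*nCk≡[k+1]*[n+1]C[k+1] n (suc k)) ⟩
    X + (suc k * X + suc (suc k) * Y)            ≡⟨ sym (+-assoc X (suc k * X) _) ⟩
    suc (suc k) * X + suc (suc k) * Y            ≡⟨ sym (*-distribˡ-+ (suc (suc k)) X Y) ⟩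
    suc (suc k) * (X + Y)                        ≡⟨ cong (suc (suc k) *_) (nCk+nC[k+1]≡[n+1]C[k+1] (suc n) (suc k)) ⟩
    suc (suc k) * (suc (suc n) C suc (suc k))    ∎
    where
    open ≡-Reasoning
    X = suc n C suc k
    Y = suc n C suc (suc k)

  n*[n∸1]Ck≡[k+1]*nC[k+1] : ∀ n k → n * ((n ∸ 1) C k) ≡ suc k * (n C suc k)
  n*[n∸1]Ck≡[k+1]*nC[k+1] zero    k =
    sym (trans (cong (suc k *_) (k>n⇒nCk≡0 {0} {suc k} (s≤s z≤n))) (*-zeroʳ (suc k)))
  n*[n∸1]Ck≡[k+1]*nC[k+1] (suc n) k = [n+1]*nCk≡[k+1]*[n+1]C[k+1] n k

  -- By Pascal's rule the increments of c ↦ c C (1 + j) are c C j, which grow with c.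
  C-convex : ∀ j d {i s} → i ≤ s → (d + i) C suc j + s C suc j ≤ (d + s) C suc j + i C suc j
  C-convex j zero    {i} {s} _   = ≤-reflexive (+-comm (i C suc j) (s C suc j))
  C-convex j (suc d) {i} {s} i≤s = begin
    suc (d + i) C suc j + s C suc j              ≡⟨ cong (_+ s C suc j) (sym (nCk+nC[k+1]≡[n+1]C[k+1] (d + i) j)) ⟩
    ((d + i) C j + (d + i) C suc j) + s C suc j  ≡⟨ +-assoc ((d + i) C j) _ _ ⟩
    (d + i) C j + ((d + i) C suc j + s C suc j)  ≤⟨ +-mono-≤ (C-monoˡ-≤ j (+-monoʳ-≤ d i≤s)) (C-convex j d i≤s) ⟩
    (d + s) C j + ((d + s) C suc j + i C suc j)  ≡⟨ sym (+-assoc ((d + s) C j) _ _) ⟩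
    ((d + s) C j + (d + s) C suc j) + i C suc j  ≡⟨ cong (_+ i C suc j) (nCk+nC[k+1]≡[n+1]C[k+1] (d + s) j) ⟩
    suc (d + s) C suc j + i C suc j              ∎
    where open ≤-Reasoning

  C-supermodular : ∀ j {i s t u} → i ≤ s → i ≤ t → u + i ≡ s + t →
                   t C suc j + s C suc j ≤ u C suc j + i C suc j
  C-supermodular j {i} {s} {t} {u} i≤s i≤t u+i≡s+t = begin
    t C suc j + s C suc j        ≡⟨ cong (λ c → c C suc j + s C suc j) t≡d+i ⟩
    (d + i) C suc j + s C suc j  ≤⟨ C-convex j d i≤s ⟩
    (d + s) C suc j + i C suc j  ≡⟨ cong (λ c → c C suc j + i C suc j) (sym u≡d+s) ⟩
    u C suc j + i C suc j        ∎
    where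
    open ≤-Reasoning
    d = t ∸ i
    t≡d+i : t ≡ d + i
    t≡d+i = sym (m∸n+n≡m i≤t)
    u≡d+s : u ≡ d + s
    u≡d+s = +-cancelʳ-≡ i u (d + s) (begin-equality
      u + i        ≡⟨ u+i≡s+t ⟩
      s + t        ≡⟨ cong (s +_) t≡d+i ⟩
      s + (d + i)  ≡⟨ sym (+-assoc s d i) ⟩
      s + d + i    ≡⟨ cong (_+ i) (+-comm s d) ⟩
      d + s + i    ∎)

  c≤s+j⇒cC[j+1]≤s*[c∸1]Cj : ∀ j {c s} → c ≤ s + j → c C suc j ≤ s * ((c ∸ 1) C j)
  c≤s+j⇒cC[j+1]≤s*[c∸1]Cj j {c} {s} c≤s+j with c ≤? j
  ... | yes c≤j = ≤-trans (≤-reflexive (k>n⇒nCk≡0 (s≤s c≤j))) z≤n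
  c≤s+j⇒cC[j+1]≤s*[c∸1]Cj j {zero}  {s}     _     | no 0≰j = contradiction z≤n 0≰j
  c≤s+j⇒cC[j+1]≤s*[c∸1]Cj j {suc c} {zero}  c<j   | no c≰j = contradiction c<j c≰j
  c≤s+j⇒cC[j+1]≤s*[c∸1]Cj j {suc c} {suc s} c<s+j | no _   = *-cancelˡ-≤ (suc j) (begin
    suc j * (suc c C suc j)    ≡⟨ sym ([n+1]*nCk≡[k+1]*[n+1]C[k+1] c j) ⟩
    suc c * (c C j)            ≤⟨ *-monoˡ-≤ (c C j) (≤-trans c<s+j (+-monoʳ-≤ (suc s) (m≤m*n j (suc s)))) ⟩
    (suc j * suc s) * (c C j)  ≡⟨ *-assoc (suc j) (suc s) (c C j) ⟩
    suc j * (suc s * (c C j))  ∎)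
    where open ≤-Reasoning

  central-gap : ∀ j → let k = suc j in (k + k) * ((k + k) C k) ≤ 4 * (((k + k ∸ 1) C j) * suc k)
  central-gap j = *-cancelˡ-≤ k (begin
    k * (n * (n C k))          ≡⟨ x∙yz≈y∙xz k n (n C k) ⟩
    n * (k * (n C k))          ≡⟨ cong (n *_) (sym (n*[n∸1]Ck≡[k+1]*nC[k+1] n j)) ⟩
    n * (n * W)                ≤⟨ m≤m+n (n * (n * W)) (4 * (k * W)) ⟩
    n * (n * W) + 4 * (k * W)  ≡⟨ expand k W ⟩
    k * (4 * (W * suc k))      ∎)
    where
    open ≤-Reasoning
    k = suc j
    n = k + k
    W = (n ∸ 1) C j
    expand : ∀ k W → (k + k) * ((k + k) * W) + 4 * (k * W) ≡ k * (4 * (W * suc k))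
    expand = solve-∀


module Subsets where

  open import Data.Nat hiding (∣_-_∣)
  open import Data.Nat.Properties
  open import Data.Bool using (if_then_else_)
  open import Data.Fin using (Fin; zero; suc)
  open import Data.Fin.Properties using (2↔Bool; *↔×)
  open import Data.Fin.Subset public
  open import Data.Fin.Subset.Properties public
  open import Data.Vec using (Vec; []; _∷_; here; there; head; tail; lookup; tabulate)
  open import Data.Vec.Properties using ([]=⇒lookup; lookup⇒[]=)
  open import Data.Product using (Σ; _×_; _,_)
  open import Data.Product.Function.NonDependent.Propositional using (_×-↔_)
  open import Data.Sum using ([_,_]′)
  open import Function using (_∘_)
  open import Function.Bundles using (_↔_; mk↔ₛ′)
  open import Function.Construct.Composition using (_↔-∘_)
  open import Relation.Binary.Lattice.Structures using (IsLattice)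
  open import Relation.Nullary using (yes; no; contradiction)

  private variable n : ℕ

  ⊆-∪-∩-isLattice : IsLattice _≡_ (_⊆_ {n}) _∪_ _∩_
  ⊆-∪-∩-isLattice {n} = record
    { isPartialOrder = ⊆-isPartialOrder n
    ; supremum       = λ p q → p⊆p∪q q , q⊆p∪q p q ,
                         λ r p⊆r q⊆r x∈p∪q → [ p⊆r , q⊆r ]′ (x∈p∪q⁻ p q x∈p∪q)
    ; infimum        = λ p q → p∩q⊆p p q , p∩q⊆q p q ,
                         λ r r⊆p r⊆q x∈r → x∈p∩q⁺ (r⊆p x∈r , r⊆q x∈r)
    }

  p⊆q⇒p∩q≡p : {p q : Subset n} → p ⊆ q → p ∩ q ≡ p
  p⊆q⇒p∩q≡p {p = p} {q} p⊆q = ⊆-antisym (p∩q⊆p p q) (λ x∈p → x∈p∩q⁺ (x∈p , p⊆q x∈p))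

  ∪-∩-modular : ∀ (p q r : Subset n) → p ⊆ r → p ∪ (q ∩ r) ≡ (p ∪ q) ∩ r
  ∪-∩-modular p q r p⊆r = begin
    p ∪ (q ∩ r)        ≡⟨ cong (_∪ (q ∩ r)) (sym (p⊆q⇒p∩q≡p p⊆r)) ⟩
    (p ∩ r) ∪ (q ∩ r)  ≡⟨ sym (∩-distribʳ-∪ r p q) ⟩
    (p ∪ q) ∩ r        ∎
    where open ≡-Reasoning

  ∣p∪q∣+∣p∩q∣≡∣p∣+∣q∣ : ∀ (p q : Subset n) → ∣ p ∪ q ∣ + ∣ p ∩ q ∣ ≡ ∣ p ∣ + ∣ q ∣
  ∣p∪q∣+∣p∩q∣≡∣p∣+∣q∣ []            []            = refl
  ∣p∪q∣+∣p∩q∣≡∣p∣+∣q∣ (outside ∷ p) (outside ∷ q) = ∣p∪q∣+∣p∩q∣≡∣p∣+∣q∣ p q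
  ∣p∪q∣+∣p∩q∣≡∣p∣+∣q∣ (outside ∷ p) (inside  ∷ q) =
    trans (cong suc (∣p∪q∣+∣p∩q∣≡∣p∣+∣q∣ p q)) (sym (+-suc ∣ p ∣ ∣ q ∣))
  ∣p∪q∣+∣p∩q∣≡∣p∣+∣q∣ (inside  ∷ p) (outside ∷ q) = cong suc (∣p∪q∣+∣p∩q∣≡∣p∣+∣q∣ p q)
  ∣p∪q∣+∣p∩q∣≡∣p∣+∣q∣ (inside  ∷ p) (inside  ∷ q) = cong suc (begin
    ∣ p ∪ q ∣ + suc ∣ p ∩ q ∣  ≡⟨ +-suc ∣ p ∪ q ∣ ∣ p ∩ q ∣ ⟩
    suc (∣ p ∪ q ∣ + ∣ p ∩ q ∣) ≡⟨ cong suc (∣p∪q∣+∣p∩q∣≡∣p∣+∣q∣ p q) ⟩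
    suc (∣ p ∣ + ∣ q ∣)         ≡⟨ sym (+-suc ∣ p ∣ ∣ q ∣) ⟩
    ∣ p ∣ + suc ∣ q ∣           ∎)
    where open ≡-Reasoning

  ∣p∣≤∣p∩q∣+∣∁q∣ : ∀ (p q : Subset n) → ∣ p ∣ ≤ ∣ p ∩ q ∣ + ∣ ∁ q ∣
  ∣p∣≤∣p∩q∣+∣∁q∣ []            []            = z≤n
  ∣p∣≤∣p∩q∣+∣∁q∣ (outside ∷ p) (outside ∷ q) =
    ≤-trans (∣p∣≤∣p∩q∣+∣∁q∣ p q) (≤-trans (n≤1+n _) (≤-reflexive (sym (+-suc _ _))))
  ∣p∣≤∣p∩q∣+∣∁q∣ (outside ∷ p) (inside  ∷ q) = ∣p∣≤∣p∩q∣+∣∁q∣ p q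
  ∣p∣≤∣p∩q∣+∣∁q∣ (inside  ∷ p) (outside ∷ q) =
    ≤-trans (s≤s (∣p∣≤∣p∩q∣+∣∁q∣ p q)) (≤-reflexive (sym (+-suc _ _)))
  ∣p∣≤∣p∩q∣+∣∁q∣ (inside  ∷ p) (inside  ∷ q) = s≤s (∣p∣≤∣p∩q∣+∣∁q∣ p q)

  x∈p⇒∣p-x∣+1≡∣p∣ : ∀ {x} {p : Subset n} → x ∈ p → suc ∣ p - x ∣ ≡ ∣ p ∣
  x∈p⇒∣p-x∣+1≡∣p∣ {p = inside ∷ p}  here         = cong (suc ∘ ∣_∣) (p─⊥≡p p)
  x∈p⇒∣p-x∣+1≡∣p∣ {p = outside ∷ p} (there x∈p) = x∈p⇒∣p-x∣+1≡∣p∣ x∈p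
  x∈p⇒∣p-x∣+1≡∣p∣ {p = inside ∷ p}  (there x∈p) = cong suc (x∈p⇒∣p-x∣+1≡∣p∣ x∈p)

  x∉p-x : ∀ (x : Fin n) (p : Subset n) → x ∉ p - x
  x∉p-x zero    (s ∷ p) ()
  x∉p-x (suc x) (s ∷ p) (there x∈p-x) = x∉p-x x p x∈p-x

  q⊆p∧x∉q⇒q⊆p-x : ∀ {x} {p q : Subset n} → q ⊆ p → x ∉ q → q ⊆ p - x
  q⊆p∧x∉q⇒q⊆p-x q⊆p x∉q y∈q = x∈p∧x≢y⇒x∈p-y (q⊆p y∈q) λ { refl → x∉q y∈q }

  subsetOfSize : ∀ {s n} → s ≤ n → Σ (Subset n) λ p → ∣ p ∣ ≡ s
  subsetOfSize {n = n} z≤n = ⊥ , ∣⊥∣≡0 n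
  subsetOfSize (s≤s s≤n) with subsetOfSize s≤n
  ... | p , ∣p∣≡s = inside ∷ p , cong suc ∣p∣≡s

  ∷-↔ : ∀ {A : Set} {n} → (A × Vec A n) ↔ Vec A (suc n)
  ∷-↔ = mk↔ₛ′ (λ (x , xs) → x ∷ xs) (λ xs → head xs , tail xs) (λ { (x ∷ xs) → refl }) (λ _ → refl)

  subsets : ∀ n → Fin (2 ^ n) ↔ Subset n
  subsets zero    = mk↔ₛ′ (λ _ → []) (λ _ → zero) (λ { [] → refl }) (λ { zero → refl })
  subsets (suc n) = ∷-↔ ↔-∘ ((2↔Bool ×-↔ subsets n) ↔-∘ *↔× {2})

  indicator : Subset n → ℕ → Fin n → ℕ
  indicator p w x = if lookup p x then w else 0

  indicator-∈ : ∀ {p : Subset n} {x} w → x ∈ p → indicator p w x ≡ w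
  indicator-∈ w x∈p = cong (if_then w else 0) ([]=⇒lookup x∈p)

  indicator-∉ : ∀ {p : Subset n} {x} w → x ∉ p → indicator p w x ≡ 0
  indicator-∉ {p = p} {x} w x∉p with lookup p x in eq
  ... | inside  = contradiction (lookup⇒[]= x p eq) x∉p
  ... | outside = refl

  indicator-mono : ∀ {p q : Subset n} {x} w → p ⊆ q → indicator p w x ≤ indicator q w x
  indicator-mono {p = p} {q} {x} w p⊆q with x ∈? p
  ... | yes x∈p = ≤-reflexive (trans (indicator-∈ w x∈p) (sym (indicator-∈ w (p⊆q x∈p))))
  ... | no  x∉p = ≤-trans (≤-reflexive (indicator-∉ w x∉p)) z≤n

  sumOver : Subset n → (Fin n → ℕ) → ℕ
  sumOver []      z = 0
  sumOver (s ∷ p) z = (if s then z zero else 0) + sumOver p (z ∘ suc)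

  zeros : (Fin n → ℕ) → Subset n
  zeros z = tabulate (λ x → z x ≡ᵇ 0)

  sumOver-1 : ∀ (p : Subset n) → sumOver p (λ _ → 1) ≡ ∣ p ∣
  sumOver-1 []            = refl
  sumOver-1 (outside ∷ p) = sumOver-1 p
  sumOver-1 (inside  ∷ p) = cong suc (sumOver-1 p)

  sumOver-indicator : ∀ (p q : Subset n) → sumOver p (indicator q 1) ≡ ∣ p ∩ q ∣
  sumOver-indicator []            []            = refl
  sumOver-indicator (outside ∷ p) (_       ∷ q) = sumOver-indicator p q
  sumOver-indicator (inside  ∷ p) (outside ∷ q) = sumOver-indicator p q
  sumOver-indicator (inside  ∷ p) (inside  ∷ q) = cong suc (sumOver-indicator p q)

  sumOver-zeros : ∀ (z : Fin n → ℕ) → sumOver (zeros z) z ≡ 0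
  sumOver-zeros {zero}  z = refl
  sumOver-zeros {suc n} z with z zero
  ... | zero  = sumOver-zeros (z ∘ suc)
  ... | suc _ = sumOver-zeros (z ∘ suc)

  n≤∣zeros∣+sumOver : ∀ (z : Fin n → ℕ) → n ≤ ∣ zeros z ∣ + sumOver ⊤ z
  n≤∣zeros∣+sumOver {zero}  z = z≤n
  n≤∣zeros∣+sumOver {suc n} z with z zero
  ... | zero  = s≤s (n≤∣zeros∣+sumOver (z ∘ suc))
  ... | suc m = begin
    suc n                                            ≤⟨ s≤s (n≤∣zeros∣+sumOver (z ∘ suc)) ⟩
    suc (∣ zeros (z ∘ suc) ∣ + sumOver ⊤ (z ∘ suc))  ≡⟨ sym (+-suc _ _) ⟩
    ∣ zeros (z ∘ suc) ∣ + suc (sumOver ⊤ (z ∘ suc))  ≤⟨ +-monoʳ-≤ ∣ zeros (z ∘ suc) ∣ (s≤s (m≤n+m _ m)) ⟩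
    ∣ zeros (z ∘ suc) ∣ + (suc m + sumOver ⊤ (z ∘ suc)) ∎
    where open ≤-Reasoning


module BinomialRank (j : ℕ) where

  open import Data.Nat hiding (∣_-_∣)
  open import Data.Nat.Properties
  open import Relation.Nullary using (yes; no)
  open Binomial
  open Subsets

  private variable n : ℕ

  rank : Subset n → ℕ
  rank p = ∣ p ∣ C suc j

  weight : Subset n → ℕ
  weight p = (∣ p ∣ ∸ 1) C j

  rank-mono : {p q : Subset n} → p ⊆ q → rank p ≤ rank q
  rank-mono p⊆q = C-monoˡ-≤ (suc j) (p⊆q⇒∣p∣≤∣q∣ p⊆q)

  rank-supermodular : ∀ (p q : Subset n) → rank q ∸ rank (p ∩ q) ≤ rank (p ∪ q) ∸ rank p
  rank-supermodular p q = begin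
    rank q ∸ rank (p ∩ q)
      ≡⟨ sym ([m+n]∸[m+o]≡n∸o (rank p) (rank q) (rank (p ∩ q))) ⟩
    (rank p + rank q) ∸ (rank p + rank (p ∩ q))
      ≤⟨ ∸-monoˡ-≤ (rank p + rank (p ∩ q)) supermodular ⟩
    (rank (p ∩ q) + rank (p ∪ q)) ∸ (rank p + rank (p ∩ q))
      ≡⟨ cong (rank (p ∩ q) + rank (p ∪ q) ∸_) (+-comm (rank p) (rank (p ∩ q))) ⟩
    (rank (p ∩ q) + rank (p ∪ q)) ∸ (rank (p ∩ q) + rank p)
      ≡⟨ [m+n]∸[m+o]≡n∸o (rank (p ∩ q)) (rank (p ∪ q)) (rank p) ⟩
    rank (p ∪ q) ∸ rank p ∎
    where
    open ≤-Reasoning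
    supermodular : rank p + rank q ≤ rank (p ∩ q) + rank (p ∪ q)
    supermodular = subst₂ _≤_ (+-comm (rank q) (rank p)) (+-comm (rank (p ∪ q)) (rank (p ∩ q)))
      (C-supermodular j (∣p∩q∣≤∣p∣ p q) (∣p∩q∣≤∣q∣ p q) (∣p∪q∣+∣p∩q∣≡∣p∣+∣q∣ p q))

  rank-remove : ∀ {x} {p : Subset n} → x ∈ p → rank p ∸ rank (p - x) ≡ weight p
  rank-remove {x = x} {p} x∈p = begin-equality
    ∣ p ∣ C suc j ∸ c C suc j                   ≡⟨ cong (λ m → m C suc j ∸ c C suc j) (sym ∣p∣≡1+c) ⟩
    suc c C suc j ∸ c C suc j                   ≡⟨ cong (_∸ c C suc j) (sym (nCk+nC[k+1]≡[n+1]C[k+1] c j)) ⟩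
    (c C j + c C suc j) ∸ c C suc j             ≡⟨ m+n∸n≡m (c C j) (c C suc j) ⟩
    c C j                                      ≡⟨ cong (λ m → (m ∸ 1) C j) ∣p∣≡1+c ⟩
    weight p                                   ∎
    where
    open ≤-Reasoning
    c = ∣ p - x ∣
    ∣p∣≡1+c : suc c ≡ ∣ p ∣
    ∣p∣≡1+c = x∈p⇒∣p-x∣+1≡∣p∣ x∈p

  truncated-entry : ∀ (p : Subset n) x →
                    indicator p (n C suc j) x ⊓ (rank p ∸ rank (p - x)) ≡ indicator p (weight p) x
  truncated-entry {n} p x with x ∈? p
  ... | yes x∈p = begin-equality
    indicator p (n C suc j) x ⊓ (rank p ∸ rank (p - x))  ≡⟨ cong₂ _⊓_ (indicator-∈ _ x∈p) (rank-remove x∈p) ⟩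
    (n C suc j) ⊓ weight p                                ≡⟨ m≥n⇒m⊓n≡n weight≤nCk ⟩
    weight p                                              ≡⟨ sym (indicator-∈ _ x∈p) ⟩
    indicator p (weight p) x                              ∎
    where
    open ≤-Reasoning
    weight≤nCk : weight p ≤ n C suc j
    weight≤nCk = begin
      weight p                   ≡⟨ sym (rank-remove x∈p) ⟩
      rank p ∸ rank (p - x)      ≤⟨ m∸n≤m (rank p) (rank (p - x)) ⟩
      rank p                     ≤⟨ C-monoˡ-≤ (suc j) (∣p∣≤n p) ⟩
      n C suc j                  ∎
  ... | no x∉p = trans (cong (_⊓ (rank p ∸ rank (p - x))) (indicator-∉ _ x∉p)) (sym (indicator-∉ _ x∉p))

  rank≤weight*∣p∩q∣ : ∀ (p q : Subset n) → ∣ ∁ q ∣ ≤ j → rank p ≤ weight p * ∣ p ∩ q ∣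
  rank≤weight*∣p∩q∣ p q ∣∁q∣≤j = ≤-trans
    (c≤s+j⇒cC[j+1]≤s*[c∸1]Cj j (≤-trans (∣p∣≤∣p∩q∣+∣∁q∣ p q) (+-monoʳ-≤ ∣ p ∩ q ∣ ∣∁q∣≤j)))
    (≤-reflexive (*-comm ∣ p ∩ q ∣ (weight p)))

  rank≤0⇒∣p∣≤j : ∀ (p : Subset n) → rank p ≤ 0 → ∣ p ∣ ≤ j
  rank≤0⇒∣p∣≤j p rank≤0 = ≮⇒≥ (λ j<∣p∣ → <⇒≱ (k≤n⇒0<nCk j<∣p∣) rank≤0)


module NaturalEmbedding where

  open import Data.Nat as ℕ using (zero; suc)
  import Data.Nat.Properties as ℕ
  open import Data.Integer as ℤ using (+_)
  import Data.Integer.Properties as ℤ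
  open import Data.Rational
  open import Data.Rational.Properties
  open import Data.Rational.Unnormalised as ℚᵘ using (ℚᵘ; mkℚᵘ; *≡*; *≤*)
  import Data.Rational.Unnormalised.Properties as ℚᵘ
  open import Algebra.Properties.Group +-0-group using (//-rightDividesʳ)
  open import Data.Fin using (Fin; zero; suc)
  open import Data.Sum using (inj₁; inj₂)
  open import Data.Vec using ([]; _∷_)
  open Subsets using (Subset; inside; outside; indicator; sumOver)

  fromℚᵘ-homo-+ : ∀ p q → fromℚᵘ (p ℚᵘ.+ q) ≡ fromℚᵘ p + fromℚᵘ q
  fromℚᵘ-homo-+ p q = toℚᵘ-injective (ℚᵘ.≃-trans (toℚᵘ-fromℚᵘ (p ℚᵘ.+ q)) (ℚᵘ.≃-sym
    (ℚᵘ.≃-trans (toℚᵘ-homo-+ (fromℚᵘ p) (fromℚᵘ q)) (ℚᵘ.+-cong (toℚᵘ-fromℚᵘ p) (toℚᵘ-fromℚᵘ q)))))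

  fromℚᵘ-homo-* : ∀ p q → fromℚᵘ (p ℚᵘ.* q) ≡ fromℚᵘ p * fromℚᵘ q
  fromℚᵘ-homo-* p q = toℚᵘ-injective (ℚᵘ.≃-trans (toℚᵘ-fromℚᵘ (p ℚᵘ.* q)) (ℚᵘ.≃-sym
    (ℚᵘ.≃-trans (toℚᵘ-homo-* (fromℚᵘ p) (fromℚᵘ q)) (ℚᵘ.*-cong (toℚᵘ-fromℚᵘ p) (toℚᵘ-fromℚᵘ q)))))

  fromℚᵘ-mono-≤ : ∀ {p q} → p ℚᵘ.≤ q → fromℚᵘ p ≤ fromℚᵘ q
  fromℚᵘ-mono-≤ {p} {q} p≤q = toℚᵘ-cancel-≤
    (ℚᵘ.≤-respʳ-≃ (ℚᵘ.≃-sym (toℚᵘ-fromℚᵘ q)) (ℚᵘ.≤-respˡ-≃ (ℚᵘ.≃-sym (toℚᵘ-fromℚᵘ p)) p≤q))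

  fromℚᵘ-cancel-≤ : ∀ {p q} → fromℚᵘ p ≤ fromℚᵘ q → p ℚᵘ.≤ q
  fromℚᵘ-cancel-≤ {p} {q} p≤q =
    ℚᵘ.≤-respʳ-≃ (toℚᵘ-fromℚᵘ q) (ℚᵘ.≤-respˡ-≃ (toℚᵘ-fromℚᵘ p) (toℚᵘ-mono-≤ p≤q))

  -- ℕ→ℚ m is fromℚᵘ (ℕ→ℚᵘ m) by definition, so it inherits the homomorphism laws of fromℚᵘ.
  ℕ→ℚᵘ : ℕ → ℚᵘ
  ℕ→ℚᵘ m = mkℚᵘ (+ m) 0

  ℕ→ℚ-+ : ∀ m n → ℕ→ℚ (m ℕ.+ n) ≡ ℕ→ℚ m + ℕ→ℚ n
  ℕ→ℚ-+ m n = trans (fromℚᵘ-cong {ℕ→ℚᵘ (m ℕ.+ n)} {ℕ→ℚᵘ m ℚᵘ.+ ℕ→ℚᵘ n} (*≡* eq))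
                    (fromℚᵘ-homo-+ (ℕ→ℚᵘ m) (ℕ→ℚᵘ n))
    where
    eq : + (m ℕ.+ n) ℤ.* + 1 ≡ (+ m ℤ.* + 1 ℤ.+ + n ℤ.* + 1) ℤ.* + 1
    eq = cong (ℤ._* + 1) (trans (ℤ.pos-+ m n) (sym (cong₂ ℤ._+_ (ℤ.*-identityʳ (+ m)) (ℤ.*-identityʳ (+ n)))))

  ℕ→ℚ-* : ∀ m n → ℕ→ℚ (m ℕ.* n) ≡ ℕ→ℚ m * ℕ→ℚ n
  ℕ→ℚ-* m n = trans (fromℚᵘ-cong {ℕ→ℚᵘ (m ℕ.* n)} {ℕ→ℚᵘ m ℚᵘ.* ℕ→ℚᵘ n} (*≡* (cong (ℤ._* + 1) (ℤ.pos-* m n))))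
                    (fromℚᵘ-homo-* (ℕ→ℚᵘ m) (ℕ→ℚᵘ n))

  ℕ→ℚ-mono-≤ : ∀ {m n} → m ℕ.≤ n → ℕ→ℚ m ≤ ℕ→ℚ n
  ℕ→ℚ-mono-≤ {m} {n} m≤n = fromℚᵘ-mono-≤ {ℕ→ℚᵘ m} {ℕ→ℚᵘ n} (*≤* (ℤ.*-monoʳ-≤-nonNeg (+ 1) (ℤ.+≤+ m≤n)))

  ℕ→ℚ-cancel-≤ : ∀ {m n} → ℕ→ℚ m ≤ ℕ→ℚ n → m ℕ.≤ n
  ℕ→ℚ-cancel-≤ {m} {n} ιm≤ιn with fromℚᵘ-cancel-≤ {ℕ→ℚᵘ m} {ℕ→ℚᵘ n} ιm≤ιn
  ... | *≤* m*1≤n*1 = ℤ.drop‿+≤+ (subst₂ ℤ._≤_ (ℤ.*-identityʳ (+ m)) (ℤ.*-identityʳ (+ n)) m*1≤n*1)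

  ℕ→ℚ-nonNeg : ∀ m → 0ℚ ≤ ℕ→ℚ m
  ℕ→ℚ-nonNeg m = ℕ→ℚ-mono-≤ {0} {m} ℕ.z≤n

  ℕ→ℚ-pos : ∀ {m} → 0 ℕ.< m → 0ℚ < ℕ→ℚ m
  ℕ→ℚ-pos 0<m = ≰⇒> (λ ιm≤0 → ℕ.<⇒≱ 0<m (ℕ→ℚ-cancel-≤ ιm≤0))

  ℕ→ℚ-⁺ : ∀ m → ℕ→ℚ m ⁺ ≡ ℕ→ℚ m
  ℕ→ℚ-⁺ m = p≥q⇒p⊔q≡p (ℕ→ℚ-nonNeg m)

  ℕ→ℚ-⊓ : ∀ m n → ℕ→ℚ (m ℕ.⊓ n) ≡ ℕ→ℚ m ⊓ ℕ→ℚ n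
  ℕ→ℚ-⊓ m n with ℕ.≤-total m n
  ... | inj₁ m≤n = trans (cong ℕ→ℚ (ℕ.m≤n⇒m⊓n≡m m≤n)) (sym (p≤q⇒p⊓q≡p (ℕ→ℚ-mono-≤ m≤n)))
  ... | inj₂ n≤m = trans (cong ℕ→ℚ (ℕ.m≥n⇒m⊓n≡n n≤m)) (sym (p≥q⇒p⊓q≡q (ℕ→ℚ-mono-≤ n≤m)))

  ℕ→ℚ-∸ : ∀ {m n} → n ℕ.≤ m → ℕ→ℚ (m ℕ.∸ n) ≡ ℕ→ℚ m - ℕ→ℚ n
  ℕ→ℚ-∸ {m} {n} n≤m = begin
    ℕ→ℚ (m ℕ.∸ n)                    ≡⟨ sym (//-rightDividesʳ (ℕ→ℚ n) (ℕ→ℚ (m ℕ.∸ n))) ⟩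
    (ℕ→ℚ (m ℕ.∸ n) + ℕ→ℚ n) - ℕ→ℚ n  ≡⟨ cong (_- ℕ→ℚ n) (sym (ℕ→ℚ-+ (m ℕ.∸ n) n)) ⟩
    ℕ→ℚ (m ℕ.∸ n ℕ.+ n) - ℕ→ℚ n      ≡⟨ cong (λ k → ℕ→ℚ k - ℕ→ℚ n) (ℕ.m∸n+n≡m n≤m) ⟩
    ℕ→ℚ m - ℕ→ℚ n                    ∎
    where open ≡-Reasoning

  ℕ→ℚ-*-inverse : ∀ d m → ℕ→ℚ (suc d ℕ.* m) * (+ 1 / suc d) ≡ ℕ→ℚ m
  ℕ→ℚ-*-inverse d m = trans (sym (fromℚᵘ-homo-* (ℕ→ℚᵘ (suc d ℕ.* m)) (mkℚᵘ (+ 1) d)))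
    (fromℚᵘ-cong {ℕ→ℚᵘ (suc d ℕ.* m) ℚᵘ.* mkℚᵘ (+ 1) d} {ℕ→ℚᵘ m} (*≡* eq))
    where
    eq : (+ (suc d ℕ.* m) ℤ.* + 1) ℤ.* + 1 ≡ + m ℤ.* + (1 ℕ.* suc d)
    eq = begin
      (+ (suc d ℕ.* m) ℤ.* + 1) ℤ.* + 1
        ≡⟨ trans (ℤ.*-identityʳ _) (ℤ.*-identityʳ _) ⟩
      + (suc d ℕ.* m)
        ≡⟨ cong +_ (trans (ℕ.*-comm (suc d) m) (cong (m ℕ.*_) (sym (ℕ.*-identityˡ (suc d))))) ⟩
      + (m ℕ.* (1 ℕ.* suc d))
        ≡⟨ ℤ.pos-* m (1 ℕ.* suc d) ⟩
      + m ℤ.* + (1 ℕ.* suc d) ∎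
      where open ≡-Reasoning

  1/[1+d]-nonNeg : ∀ d → 0ℚ ≤ + 1 / suc d
  1/[1+d]-nonNeg d = fromℚᵘ-mono-≤ {ℕ→ℚᵘ 0} {mkℚᵘ (+ 1) d} (*≤* (ℤ.+≤+ ℕ.z≤n))

  sumFin-cong : ∀ n {f g : Fin n → ℚ} → (∀ e → f e ≡ g e) → sumFin n f ≡ sumFin n g
  sumFin-cong zero    f≗g = refl
  sumFin-cong (suc n) f≗g = cong₂ _+_ (f≗g zero) (sumFin-cong n (λ e → f≗g (suc e)))

  sumFin-*ʳ : ∀ n (f : Fin n → ℚ) q → sumFin n (λ e → f e * q) ≡ sumFin n f * q
  sumFin-*ʳ zero    f q = sym (*-zeroˡ q)
  sumFin-*ʳ (suc n) f q =
    trans (cong (_+_ (f zero * q)) (sumFin-*ʳ n (λ e → f (suc e)) q)) (sym (*-distribʳ-+ q (f zero) _))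

  sumFin-indicator : ∀ {n} (p : Subset n) w (z : Fin n → ℕ) →
                     sumFin n (λ e → ℕ→ℚ (indicator p w e) * ℕ→ℚ (z e)) ≡ ℕ→ℚ (w ℕ.* sumOver p z)
  sumFin-indicator []            w z = cong ℕ→ℚ (sym (ℕ.*-zeroʳ w))
  sumFin-indicator {suc n} (outside ∷ p) w z = begin
    0ℚ * ℕ→ℚ (z zero) + rest  ≡⟨ cong (_+ rest) (*-zeroˡ (ℕ→ℚ (z zero))) ⟩
    0ℚ + rest                 ≡⟨ +-identityˡ rest ⟩
    rest                      ≡⟨ sumFin-indicator p w (λ e → z (suc e)) ⟩
    ℕ→ℚ (w ℕ.* sumOver p (λ e → z (suc e)))  ∎
    where
    open ≡-Reasoning
    rest = sumFin n (λ e → ℕ→ℚ (indicator p w e) * ℕ→ℚ (z (suc e)))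
  sumFin-indicator {suc n} (inside ∷ p) w z = begin
    ℕ→ℚ w * ℕ→ℚ (z zero) + sumFin n (λ e → ℕ→ℚ (indicator p w e) * ℕ→ℚ (z (suc e)))
      ≡⟨ cong₂ _+_ (sym (ℕ→ℚ-* w (z zero))) (sumFin-indicator p w (λ e → z (suc e))) ⟩
    ℕ→ℚ (w ℕ.* z zero) + ℕ→ℚ (w ℕ.* rest)
      ≡⟨ sym (ℕ→ℚ-+ (w ℕ.* z zero) (w ℕ.* rest)) ⟩
    ℕ→ℚ (w ℕ.* z zero ℕ.+ w ℕ.* rest)
      ≡⟨ cong ℕ→ℚ (sym (ℕ.*-distribˡ-+ w (z zero) rest)) ⟩
    ℕ→ℚ (w ℕ.* (z zero ℕ.+ rest)) ∎
    where
    open ≡-Reasoning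
    rest = sumOver p (λ e → z (suc e))


module _ {A B : Set} (f : A ↔ B) where

  open Inverse f using (to; from; strictlyInverseˡ)

  pullback-isLattice : ∀ {_≤_ : B → B → Set} {_∨_ _∧_} → IsLattice _≡_ _≤_ _∨_ _∧_ →
                       IsLattice _≡_ (λ x y → to x ≤ to y)
                                 (λ x y → from (to x ∨ to y)) (λ x y → from (to x ∧ to y))
  pullback-isLattice {_≤_} L = record
    { isPartialOrder = record
      { isPreorder = record
        { isEquivalence = isEquivalence
        ; reflexive     = λ x≡y → reflexive (cong to x≡y)
        ; trans         = ≤-trans
        }
      ; antisym = λ x≤y y≤x → Injection.injective (Inverse⇒Injection f) (antisym x≤y y≤x)
      }
    ; supremum = λ x y → subst (to x ≤_) (sym (strictlyInverseˡ _)) (x≤x∨y (to x) (to y))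
                       , subst (to y ≤_) (sym (strictlyInverseˡ _)) (y≤x∨y (to x) (to y))
                       , λ z x≤z y≤z → subst (_≤ to z) (sym (strictlyInverseˡ _)) (∨-least x≤z y≤z)
    ; infimum  = λ x y → subst (_≤ to x) (sym (strictlyInverseˡ _)) (x∧y≤x (to x) (to y))
                       , subst (_≤ to y) (sym (strictlyInverseˡ _)) (x∧y≤y (to x) (to y))
                       , λ z z≤x z≤y → subst (to z ≤_) (sym (strictlyInverseˡ _)) (∧-greatest z≤x z≤y)
    }
    where
    open IsLattice L using (reflexive; antisym; x≤x∨y; y≤x∨y; ∨-least; x∧y≤x; x∧y≤y; ∧-greatest)
                     renaming (trans to ≤-trans)


module BinomialGreedySystem (n j : ℕ) (j<n : j Data.Nat.< n) where

  open import Data.Nat as ℕ using (suc)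
  import Data.Nat.Properties as ℕ
  open import Data.Fin using (Fin)
  open import Data.Integer using (+_)
  open import Data.Rational using (ℚ; 0ℚ; _*_; _-_; _⊓_; _≤_; _<_; _/_; nonNegative)
  open import Data.Rational.Properties
    using (≤-reflexive; ≤-trans; <-irrefl; *-identityʳ; *-monoʳ-≤-nonNeg; module ≤-Reasoning)
  open import Data.Sum using (inj₁; inj₂)
  open import Data.Product using (proj₁; proj₂)
  open import Function using (_∘_; Equivalence)
  open import Relation.Nullary using (¬_; yes; no; contradiction)
  open Binomial using (_C_; k≤n⇒0<nCk; n*[n∸1]Ck≡[k+1]*nC[k+1])
  open Subsets hiding (_-_)
  open BinomialRank j
  open NaturalEmbedding

  open Inverse (subsets n) using () renaming (to to set; from to index; strictlyInverseˡ to set-index)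

  m : ℕ
  m = 2 ℕ.^ n

  α : ℕ
  α = n C suc j

  a : Fin m → Fin n → ℚ
  a i e = ℕ→ℚ (indicator (set i) α e)

  r : Fin m → ℚ
  r i = ℕ→ℚ (rank (set i))

  _≼_ : Fin m → Fin m → Set
  i ≼ i′ = set i ⊆ set i′

  _∨_ : Fin m → Fin m → Fin m
  i ∨ i′ = index (set i ∪ set i′)

  _∧_ : Fin m → Fin m → Fin m
  i ∧ i′ = index (set i ∩ set i′)

  φ : Fin n → Fin m → Fin m
  φ e i = index (set i ─ ⁅ e ⁆)

  ∈⇒0<a : ∀ {i e} → e ∈ set i → 0ℚ < a i e
  ∈⇒0<a e∈i = subst (0ℚ <_) (cong ℕ→ℚ (sym (indicator-∈ α e∈i))) (ℕ→ℚ-pos (k≤n⇒0<nCk j<n))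

  0<a⇒∈ : ∀ {i e} → 0ℚ < a i e → e ∈ set i
  0<a⇒∈ {i} {e} 0<a with e ∈? set i
  ... | yes e∈i = e∈i
  ... | no  e∉i = contradiction (subst (0ℚ <_) (cong ℕ→ℚ (indicator-∉ α e∉i)) 0<a) (<-irrefl refl)

  joinSupp : ∀ i i′ e → ¬ (0ℚ < a i e) → ¬ (0ℚ < a i′ e) → ¬ (0ℚ < a (i ∨ i′) e)
  joinSupp i i′ e e∉i e∉i′ 0<a∨ with x∈p∪q⁻ (set i) (set i′) (subst (e ∈_) (set-index _) (0<a⇒∈ 0<a∨))
  ... | inj₁ e∈i  = e∉i (∈⇒0<a e∈i)
  ... | inj₂ e∈i′ = e∉i′ (∈⇒0<a e∈i′)

  r-supermodular : ∀ S T → r T - r (S ∧ T) ≤ r (S ∨ T) - r S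
  r-supermodular S T = begin
    r T - r (S ∧ T)
      ≡⟨ cong (λ p → r T - ℕ→ℚ (rank p)) (set-index (set S ∩ set T)) ⟩
    ℕ→ℚ (rank (set T)) - ℕ→ℚ (rank (set S ∩ set T))
      ≡⟨ sym (ℕ→ℚ-∸ (rank-mono (p∩q⊆q (set S) (set T)))) ⟩
    ℕ→ℚ (rank (set T) ℕ.∸ rank (set S ∩ set T))
      ≤⟨ ℕ→ℚ-mono-≤ (rank-supermodular (set S) (set T)) ⟩
    ℕ→ℚ (rank (set S ∪ set T) ℕ.∸ rank (set S))
      ≡⟨ ℕ→ℚ-∸ (rank-mono (p⊆p∪q {p = set S} (set T))) ⟩
    ℕ→ℚ (rank (set S ∪ set T)) - r S
      ≡⟨ cong (λ p → ℕ→ℚ (rank p) - r S) (sym (set-index (set S ∪ set T))) ⟩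
    r (S ∨ T) - r S ∎
    where open ≤-Reasoning

  -- As a takes the value α on every support, e ∉ S ∧ T is not needed.
  P4 : ∀ S T e → 0ℚ < a T e → ¬ (0ℚ < a (S ∧ T) e) →
       ((r T - r (S ∧ T)) * a (S ∨ T) e) ≤ ((r (S ∨ T) - r S) * a T e)
  P4 S T e 0<aT _ = begin
    (r T - r (S ∧ T)) * a (S ∨ T) e
      ≡⟨ cong ((r T - r (S ∧ T)) *_) (a-on-support e∈S∨T) ⟩
    (r T - r (S ∧ T)) * ℕ→ℚ α
      ≤⟨ *-monoʳ-≤-nonNeg (ℕ→ℚ α) {{nonNegative (ℕ→ℚ-nonNeg α)}} (r-supermodular S T) ⟩
    (r (S ∨ T) - r S) * ℕ→ℚ α
      ≡⟨ cong ((r (S ∨ T) - r S) *_) (sym (a-on-support e∈T)) ⟩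
    (r (S ∨ T) - r S) * a T e ∎
    where
    open ≤-Reasoning
    a-on-support : ∀ {i} → e ∈ set i → a i e ≡ ℕ→ℚ α
    a-on-support e∈i = cong ℕ→ℚ (indicator-∈ α e∈i)
    e∈T : e ∈ set T
    e∈T = 0<a⇒∈ 0<aT
    e∈S∨T : e ∈ set (S ∨ T)
    e∈S∨T = subst (e ∈_) (sym (set-index _)) (q⊆p∪q (set S) (set T) e∈T)

  modular : ∀ x y z → x ≼ z → (x ∨ (y ∧ z)) ≡ ((x ∨ y) ∧ z)
  modular x y z x≼z = cong index (begin
    set x ∪ set (index (set y ∩ set z))  ≡⟨ cong (set x ∪_) (set-index _) ⟩
    set x ∪ (set y ∩ set z)              ≡⟨ ∪-∩-modular (set x) (set y) (set z) x≼z ⟩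
    (set x ∪ set y) ∩ set z              ≡⟨ cong (_∩ set z) (sym (set-index _)) ⟩
    set (index (set x ∪ set y)) ∩ set z  ∎)
    where open ≡-Reasoning

  G : GreedySystem n m
  G = record
    { a            = a
    ; r            = r
    ; _≼_          = _≼_
    ; _∨_          = _∨_
    ; _∧_          = _∧_
    ; a-nonneg     = λ i e → ℕ→ℚ-nonNeg (indicator (set i) α e)
    ; P1           = λ i i′ i≼i′ → ℕ→ℚ-mono-≤ (rank-mono i≼i′)
    ; P2           = λ i i′ i≼i′ e → ℕ→ℚ-mono-≤ (indicator-mono α i≼i′)
    ; lattice      = pullback-isLattice (subsets n) ⊆-∪-∩-isLattice
    ; modular      = modular
    ; distinctSupp = λ i i′ same → Injection.injective (Inverse⇒Injection (subsets n))
                       (⊆-antisym (0<a⇒∈ ∘ Equivalence.to (same _) ∘ ∈⇒0<a)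
                                  (0<a⇒∈ ∘ Equivalence.from (same _) ∘ ∈⇒0<a))
    ; joinSupp     = joinSupp
    ; P4           = P4
    }

  isPhi : GreedySystem.IsPhi G φ
  isPhi e i = φ≼ , e∉φ , maximal
    where
    set-φ : set (φ e i) ≡ set i ─ ⁅ e ⁆
    set-φ = set-index (set i ─ ⁅ e ⁆)
    φ≼ : φ e i ≼ i
    φ≼ = subst (_⊆ set i) (sym set-φ) (p─q⊆p (set i) ⁅ e ⁆)
    e∉φ : ¬ (0ℚ < a (φ e i) e)
    e∉φ = x∉p-x e (set i) ∘ subst (e ∈_) set-φ ∘ 0<a⇒∈
    maximal : ∀ i′ → i′ ≼ i → ¬ (0ℚ < a i′ e) → i′ ≼ φ e i
    maximal i′ i′≼i e∉i′ = subst (set i′ ⊆_) (sym set-φ) (q⊆p∧x∉q⇒q⊆p-x i′≼i (e∉i′ ∘ ∈⇒0<a))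

  A′ : Fin m → Fin n → ℚ
  A′ = GreedySystem.trunc G φ

  truncation : ∀ i e → A′ i e ≡ ℕ→ℚ (indicator (set i) (weight (set i)) e)
  truncation i e = begin
    a i e ⊓ ((r i ⁺) - (r (φ e i) ⁺))
      ≡⟨ cong₂ (λ x y → a i e ⊓ (x - y)) (ℕ→ℚ-⁺ (rank S)) (ℕ→ℚ-⁺ (rank (set (φ e i)))) ⟩
    a i e ⊓ (r i - ℕ→ℚ (rank (set (φ e i))))
      ≡⟨ cong (λ p → a i e ⊓ (r i - ℕ→ℚ (rank p))) (set-index (S ─ ⁅ e ⁆)) ⟩
    a i e ⊓ (r i - ℕ→ℚ (rank (S ─ ⁅ e ⁆)))
      ≡⟨ cong (a i e ⊓_) (sym (ℕ→ℚ-∸ (rank-mono (p─q⊆p S ⁅ e ⁆)))) ⟩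
    a i e ⊓ ℕ→ℚ (rank S ℕ.∸ rank (S ─ ⁅ e ⁆))
      ≡⟨ sym (ℕ→ℚ-⊓ (indicator S α e) (rank S ℕ.∸ rank (S ─ ⁅ e ⁆))) ⟩
    ℕ→ℚ (indicator S α e ℕ.⊓ (rank S ℕ.∸ rank (S ─ ⁅ e ⁆)))
      ≡⟨ cong ℕ→ℚ (truncated-entry S e) ⟩
    ℕ→ℚ (indicator S (weight S) e) ∎
    where
    open ≡-Reasoning
    S = set i

  rowSum : Fin m → (Fin n → ℚ) → ℚ
  rowSum i x = sumFin n (λ e → A′ i e * x e)

  rowSum-ℕ : ∀ i (z : Fin n → ℕ) → rowSum i (ℕ→ℚ ∘ z) ≡ ℕ→ℚ (weight (set i) ℕ.* sumOver (set i) z)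
  rowSum-ℕ i z = trans (sumFin-cong n (λ e → cong (_* ℕ→ℚ (z e)) (truncation i e)))
                       (sumFin-indicator (set i) (weight (set i)) z)

  xLP : Fin n → ℚ
  xLP _ = + 1 / suc j

  rowSum-xLP : ∀ i → rowSum i xLP ≡ r i
  rowSum-xLP i = begin
    rowSum i xLP
      ≡⟨ sumFin-*ʳ n (A′ i) (+ 1 / suc j) ⟩
    sumFin n (A′ i) * (+ 1 / suc j)
      ≡⟨ cong (_* (+ 1 / suc j)) (sumFin-cong n (λ e → sym (*-identityʳ (A′ i e)))) ⟩
    rowSum i (λ _ → ℕ→ℚ 1) * (+ 1 / suc j)
      ≡⟨ cong (_* (+ 1 / suc j)) (rowSum-ℕ i (λ _ → 1)) ⟩
    ℕ→ℚ (weight S ℕ.* sumOver S (λ _ → 1)) * (+ 1 / suc j)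
      ≡⟨ cong (λ c → ℕ→ℚ c * (+ 1 / suc j)) (begin
        weight S ℕ.* sumOver S (λ _ → 1)
          ≡⟨ cong (weight S ℕ.*_) (sumOver-1 S) ⟩
        weight S ℕ.* ∣ S ∣
          ≡⟨ ℕ.*-comm (weight S) ∣ S ∣ ⟩
        ∣ S ∣ ℕ.* weight S
          ≡⟨ n*[n∸1]Ck≡[k+1]*nC[k+1] ∣ S ∣ j ⟩
        suc j ℕ.* rank S ∎) ⟩
    ℕ→ℚ (suc j ℕ.* rank S) * (+ 1 / suc j)      ≡⟨ ℕ→ℚ-*-inverse j (rank S) ⟩
    r i                                         ∎
    where
    open ≡-Reasoning
    S = set i

  xLP-feasible : FeasibleQ A′ r xLP
  xLP-feasible = (λ _ → 1/[1+d]-nonNeg j) , (λ i → ≤-reflexive (sym (rowSum-xLP i)))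

  E : Subset n
  E = ⊤

  top : Fin m
  top = index E

  xLP-optimal : ∀ y → FeasibleQ A′ r y → cost (A′ top) xLP ≤ cost (A′ top) y
  xLP-optimal y (_ , y-feasible) = ≤-trans (≤-reflexive (rowSum-xLP top)) (y-feasible top)

  cost-xLP : cost (A′ top) xLP ≡ ℕ→ℚ (n C suc j)
  cost-xLP = trans (rowSum-xLP top) (cong (λ c → ℕ→ℚ (c C suc j))
                                          (trans (cong ∣_∣ (set-index E)) (∣⊤∣≡n n)))

  O : Subset n
  O = proj₁ (subsetOfSize (ℕ.m∸n≤m n j))

  ∣O∣≡n∸j : ∣ O ∣ ≡ n ℕ.∸ j
  ∣O∣≡n∸j = proj₂ (subsetOfSize (ℕ.m∸n≤m n j))

  xIP : Fin n → ℕ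
  xIP = indicator O 1

  xIP-feasible : FeasibleN A′ r xIP
  xIP-feasible = (λ e → ℕ→ℚ-nonNeg (xIP e)) , λ i → begin
    r i
      ≤⟨ ℕ→ℚ-mono-≤ (rank≤weight*∣p∩q∣ (set i) O (ℕ.≤-reflexive ∣∁O∣≡j)) ⟩
    ℕ→ℚ (weight (set i) ℕ.* ∣ set i ∩ O ∣)
      ≡⟨ cong (λ c → ℕ→ℚ (weight (set i) ℕ.* c)) (sym (sumOver-indicator (set i) O)) ⟩
    ℕ→ℚ (weight (set i) ℕ.* sumOver (set i) xIP)
      ≡⟨ sym (rowSum-ℕ i xIP) ⟩
    rowSum i (ℕ→ℚ ∘ xIP) ∎
    where
    open ≤-Reasoning
    ∣∁O∣≡j : ∣ ∁ O ∣ ≡ j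
    ∣∁O∣≡j = trans (∣∁p∣≡n∸∣p∣ O) (trans (cong (n ℕ.∸_) ∣O∣≡n∸j) (ℕ.m∸[m∸n]≡n (ℕ.<⇒≤ j<n)))

  feasible⇒∣zeros∣≤j : ∀ z → FeasibleN A′ r z → ∣ zeros z ∣ ℕ.≤ j
  feasible⇒∣zeros∣≤j z (_ , z-feasible) = rank≤0⇒∣p∣≤j Z (ℕ→ℚ-cancel-≤ (begin
    ℕ→ℚ (rank Z)
      ≡⟨ cong (ℕ→ℚ ∘ rank) (sym (set-index Z)) ⟩
    r (index Z)
      ≤⟨ z-feasible (index Z) ⟩
    rowSum (index Z) (ℕ→ℚ ∘ z)
      ≡⟨ rowSum-ℕ (index Z) z ⟩
    ℕ→ℚ (weight (set (index Z)) ℕ.* sumOver (set (index Z)) z)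
                                      ≡⟨ cong (λ p → ℕ→ℚ (weight p ℕ.* sumOver p z)) (set-index Z) ⟩
    ℕ→ℚ (weight Z ℕ.* sumOver Z z)
      ≡⟨ cong (λ c → ℕ→ℚ (weight Z ℕ.* c)) (sumOver-zeros z) ⟩
    ℕ→ℚ (weight Z ℕ.* 0)
      ≡⟨ cong ℕ→ℚ (ℕ.*-zeroʳ (weight Z)) ⟩
    ℕ→ℚ 0 ∎))
    where
    open ≤-Reasoning
    Z = zeros z

  cost-ℕ : ∀ (z : Fin n → ℕ) → cost (A′ top) (ℕ→ℚ ∘ z) ≡ ℕ→ℚ (weight E ℕ.* sumOver E z)
  cost-ℕ z = trans (rowSum-ℕ top z) (cong (λ p → ℕ→ℚ (weight p ℕ.* sumOver p z)) (set-index E))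

  sumOver-xIP : sumOver E xIP ≡ n ℕ.∸ j
  sumOver-xIP = trans (sumOver-indicator E O) (trans (cong ∣_∣ (∩-identityˡ O)) ∣O∣≡n∸j)

  xIP-optimal : ∀ z → FeasibleN A′ r z → cost (A′ top) (ℕ→ℚ ∘ xIP) ≤ cost (A′ top) (ℕ→ℚ ∘ z)
  xIP-optimal z z-feasible = begin
    cost (A′ top) (ℕ→ℚ ∘ xIP)
      ≡⟨ cost-ℕ xIP ⟩
    ℕ→ℚ (weight E ℕ.* sumOver E xIP)
      ≤⟨ ℕ→ℚ-mono-≤ (ℕ.*-monoʳ-≤ (weight E) (ℕ.≤-trans (ℕ.≤-reflexive sumOver-xIP) n∸j≤∑z)) ⟩
    ℕ→ℚ (weight E ℕ.* sumOver E z)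
      ≡⟨ sym (cost-ℕ z) ⟩
    cost (A′ top) (ℕ→ℚ ∘ z) ∎
    where
    open ≤-Reasoning
    n∸j≤∑z : n ℕ.∸ j ℕ.≤ sumOver E z
    n∸j≤∑z = ℕ.m≤n+o⇒m∸n≤o n j (ℕ.≤-trans (n≤∣zeros∣+sumOver z)
                                          (ℕ.+-monoˡ-≤ (sumOver E z) (feasible⇒∣zeros∣≤j z z-feasible)))

  cost-xIP : cost (A′ top) (ℕ→ℚ ∘ xIP) ≡ ℕ→ℚ (((n ℕ.∸ 1) C j) ℕ.* (n ℕ.∸ j))
  cost-xIP = trans (cost-ℕ xIP) (cong₂ (λ c s → ℕ→ℚ (((c ℕ.∸ 1) C j) ℕ.* s)) (∣⊤∣≡n n) sumOver-xIP)

  A′-nonNeg : ∀ i e → 0ℚ ≤ A′ i e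
  A′-nonNeg i e = subst (0ℚ ≤_) (sym (truncation i e)) (ℕ→ℚ-nonNeg (indicator (set i) (weight (set i)) e))

  cost-xLP-pos : 0ℚ < cost (A′ top) xLP
  cost-xLP-pos = subst (0ℚ <_) (sym cost-xLP) (ℕ→ℚ-pos (k≤n⇒0<nCk j<n))


module CentralBinomialSystem (j : ℕ) where

  open import Data.Nat as ℕ using (suc)
  import Data.Nat.Properties as ℕ
  open import Data.Integer using (+_)
  open import Data.Rational using (_*_; _≤_; _/_; nonNegative)
  open import Data.Rational.Properties using (*-assoc; *-comm; *-monoʳ-≤-nonNeg; module ≤-Reasoning)
  open import Function using (_∘_)
  open Binomial using (_C_; central-gap)
  open NaturalEmbedding

  k : ℕ
  k = suc j

  n : ℕ
  n = k ℕ.+ k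

  open BinomialGreedySystem n j (ℕ.s≤s (ℕ.m≤m+n j k)) public

  n≥j : n ℕ.≥ j
  n≥j = ℕ.≤-trans (ℕ.n≤1+n j) (ℕ.m≤m+n k k)

  gap : ((+ 1 / 4) * ℕ→ℚ n) * cost (A′ top) xLP ≤ cost (A′ top) (ℕ→ℚ ∘ xIP)
  gap = begin
    (¼ * ℕ→ℚ n) * cost (A′ top) xLP
      ≡⟨ cong ((¼ * ℕ→ℚ n) *_) cost-xLP ⟩
    (¼ * ℕ→ℚ n) * ℕ→ℚ (n C k)
      ≡⟨ *-assoc ¼ (ℕ→ℚ n) (ℕ→ℚ (n C k)) ⟩
    ¼ * (ℕ→ℚ n * ℕ→ℚ (n C k))
      ≡⟨ *-comm ¼ (ℕ→ℚ n * ℕ→ℚ (n C k)) ⟩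
    (ℕ→ℚ n * ℕ→ℚ (n C k)) * ¼
      ≡⟨ cong (_* ¼) (sym (ℕ→ℚ-* n (n C k))) ⟩
    ℕ→ℚ (n ℕ.* (n C k)) * ¼
      ≤⟨ *-monoʳ-≤-nonNeg ¼ {{nonNegative (1/[1+d]-nonNeg 3)}} (ℕ→ℚ-mono-≤ (central-gap j)) ⟩
    ℕ→ℚ (4 ℕ.* (W ℕ.* suc k)) * ¼
      ≡⟨ ℕ→ℚ-*-inverse 3 (W ℕ.* suc k) ⟩
    ℕ→ℚ (W ℕ.* suc k)
      ≡⟨ cong (λ c → ℕ→ℚ (W ℕ.* c)) (sym n∸j≡1+k) ⟩
    ℕ→ℚ (W ℕ.* (n ℕ.∸ j))
      ≡⟨ sym cost-xIP ⟩
    cost (A′ top) (ℕ→ℚ ∘ xIP) ∎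
    where
    open ≤-Reasoning
    ¼ = + 1 / 4
    W = (n ℕ.∸ 1) C j
    n∸j≡1+k : n ℕ.∸ j ≡ suc k
    n∸j≡1+k = trans (cong (ℕ._∸ j) (sym (ℕ.+-suc j k))) (ℕ.m+n∸m≡n j (suc k))


open import Data.Nat using (ℕ; _≥_)
open import Data.Fin using (Fin)
open import Data.Rational using (ℚ; 0ℚ; _≤_; _<_; _*_)
open import Data.Product using (Σ; _×_; _,_)
open import Data.Integer using (+_)
open import Data.Rational using (_/_)
open import Data.Rational.Properties using (positive⁻¹)

proposition2 : Σ ℚ λ κ → (0ℚ < κ) × (∀ N → Σ ℕ λ n → Σ ℕ λ m → (n ≥ N) ×
  Σ (GreedySystem n m) λ G → Σ (Fin n → Fin m → Fin m) λ φ →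
  GreedySystem.IsPhi G φ × Σ (Fin n → ℚ) λ c → (∀ e → 0ℚ ≤ c e) ×
  Σ (Fin n → ℚ) λ xLP → Σ (Fin n → ℕ) λ xIP →
  FeasibleQ (GreedySystem.trunc G φ) (GreedySystem.r G) xLP ×
  (∀ y → FeasibleQ (GreedySystem.trunc G φ) (GreedySystem.r G) y → cost c xLP ≤ cost c y) ×
  FeasibleN (GreedySystem.trunc G φ) (GreedySystem.r G) xIP ×
  (∀ z → FeasibleN (GreedySystem.trunc G φ) (GreedySystem.r G) z → cost c (λ e → ℕ→ℚ (xIP e)) ≤ cost c (λ e → ℕ→ℚ (z e))) ×
  (0ℚ < cost c xLP) ×
  ((κ * ℕ→ℚ n) * cost c xLP ≤ cost c (λ e → ℕ→ℚ (xIP e))))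
proposition2 = + 1 / 4 , positive⁻¹ (+ 1 / 4) , λ N →
  let open CentralBinomialSystem N in
  n , m , n≥j , G , φ , isPhi , A′ top , A′-nonNeg top , xLP , xIP ,
  xLP-feasible , xLP-optimal , xIP-feasible , xIP-optimal , cost-xLP-pos , gap
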